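{- Let $\mathcal{P}$ be a mobile poset with underlying ribbon $\mathcal{Z}=\mathcal{Z}^{(\ell)}_S$ and let $F$ be the set of path folds for $\mathcal{P}$. Then the component tree $C(\mathcal{P}_F)$ is a path.
   Context: $x\lessdot y$ means $y$ covers $x$; a cover relation is recorded as $(x,y)$. Ribbon $\mathcal{Z}^{(\ell)}_S$: poset on $z_1,\dots,z_\ell$ with $z_{i+1}\lessdot z_i$ for $i\in S$ and $z_i\lessdot z_{i+1}$ for $i\in[\ell-1]\setminus S$. $d$-complete posets: for $k\ge3$, $d_k(1)$ consists of a chain $c_1<\dots<c_{k-2}$, two incomparable elements $x,y$ covering $c_{k-2}$, and a chain $n_1<\dots<n_{k-2}$ with $n_1$ covering $x$ and $y$ (the neck). A $d_k$-interval is an interval $[w,z]$ isomorphic to $d_k(1)$; a $d_k^-$-convex set is a convex subset isomorphic to $d_k(1)$ minus its maximum. A poset is $d$-complete if for all $k\ge3$: (1) every $d_k^-$-convex set $I$ has an element $p$ covering its maximal elements with $I\cup\{p\}$ a $d_k$-interval; (2) the top $z$ of a $d_k$-interval $[w,z]$ covers no element outside it; (3) no two $d_k^-$-convex sets differ only in their minimal elements. The top tree of a connected $d$-complete poset is the set of $x$ such that each $y\ge x$ is covered by at most one element; an element is acyclic if it lies in the top tree and in no neck of a $d_k$-interval. Mobile posets: from $\mathcal{Z}$: (i) for each $z\in\mathcal{Z}$ attach $m_z\ge0$ disjoint connected $d$-complete posets by making $z$ cover their maximal elements; (ii) optionally, for one $z'=z_j$ (the anchor), attach a disjoint connected $d$-complete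 poset $\mathcal{Q}$ by adding $z'\lessdot q$ for an acyclic $q\in\mathcal{Q}$; take transitive closures. Free-standing (w.r.t. $\mathcal{Z}$) means (ii) not used. Folds: $\mathcal{P}\ominus F$ has order generated by cover relations not in $F$; $\mathcal{P}_F$ is obtained from it by adding $y<x$ for each $(x,y)\in F$ and taking transitive closure. Path folds: $F=\{(z_{i+1},z_i): i\in S\}$ if free-standing, else $F=\{(z_{i+1},z_i): i\in S,i<j\}\cup\{(z_i,z_{i+1}): i\notin S,i\ge j\}$. The component tree $C(\mathcal{P}_F)$ has vertices the connected components of $\mathcal{P}\ominus F$ and an edge between the components of $x$ and $y$ for each $(x,y)\in F$. -}

module Defs where

open import Level using (0ℓ)
open import Data.Nat using (ℕ; zero; suc; _≤_; _<_; _<ᵇ_)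
open import Data.Fin using (Fin; toℕ; fromℕ; inject₁)
  renaming (suc to fsuc)
open import Data.Bool using (Bool; true; false; T; not; if_then_else_)
open import Data.Maybe using (Maybe; just; nothing)
open import Data.Product using (Σ; ∃; ∃-syntax; _×_; _,_; proj₁; proj₂)
open import Data.Sum using (_⊎_)
open import Data.Unit using (⊤)
open import Data.Empty using (⊥)
open import Relation.Nullary using (¬_)
open import Relation.Binary using (Rel; Decidable; IsPartialOrder)
open import Relation.Binary.PropositionalEquality using (_≡_; _≢_)
open import Relation.Binary.Construct.Closure.ReflexiveTransitive using (Star)
open import Relation.Binary.Construct.Closure.Equivalence using (EqClosure)
open import Function.Bundles using (_↔_; _⇔_; Inverse)

record FPoset : Set₁ where
  field
    Carrier        : Set
    _≤P_           : Rel Carrier 0ℓ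
    isPartialOrder : IsPartialOrder _≡_ _≤P_
    ≤-dec          : Decidable _≤P_
    size           : ℕ
    enum           : Fin size ↔ Carrier

module PosetNotions (P : FPoset) where
  open FPoset P

  _<P_ : Carrier → Carrier → Set
  x <P y = x ≤P y × x ≢ y

  _⋖_ : Carrier → Carrier → Set
  x ⋖ y = x <P y × (∀ u → ¬ (x <P u × u <P y))

  Maximal : Carrier → Set
  Maximal a = ∀ b → a ≤P b → b ≡ a

  Connected : Set
  Connected = Carrier × (∀ a b → EqClosure _≤P_ a b)

-- The poset d_k(1), for k = r + 3 (so the chains have k - 2 = r + 1 elements)
--   c i : the bottom chain c_1 < ... < c_{k-2}
--   x, y : the two incomparable middle elements
--   n i : the neck n_1 < ... < n_{k-2}

data DK (r : ℕ) : Set where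
  c : Fin (suc r) → DK r
  x : DK r
  y : DK r
  n : Fin (suc r) → DK r

_≤D_ : ∀ {r} → DK r → DK r → Set
c i ≤D c j = toℕ i ≤ toℕ j
c i ≤D x   = ⊤
c i ≤D y   = ⊤
c i ≤D n j = ⊤
x   ≤D c j = ⊥
x   ≤D x   = ⊤
x   ≤D y   = ⊥
x   ≤D n j = ⊤
y   ≤D c j = ⊥
y   ≤D x   = ⊥
y   ≤D y   = ⊤
y   ≤D n j = ⊤
n i ≤D c j = ⊥
n i ≤D x   = ⊥
n i ≤D y   = ⊥
n i ≤D n j = toℕ i ≤ toℕ j

Whole : ∀ {r} → DK r → Set
Whole _ = ⊤

NotTop : ∀ {r} → DK r → Set
NotTop {r} d = d ≢ n (fromℕ r)

module DComplete (P : FPoset) where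
  open FPoset P
  open PosetNotions P

  record Iso (r : ℕ) (A : Carrier → Set) (B : DK r → Set) : Set where
    field
      to       : Σ Carrier A → Σ (DK r) B
      from     : Σ (DK r) B → Σ Carrier A
      from-to  : ∀ a → proj₁ (from (to a)) ≡ proj₁ a
      to-from  : ∀ d → proj₁ (to (from d)) ≡ proj₁ d
      order    : ∀ a b → (proj₁ a ≤P proj₁ b) ⇔ (proj₁ (to a) ≤D proj₁ (to b))

  Mem : (Carrier → Bool) → Carrier → Set
  Mem I a = T (I a)

  Convex : (Carrier → Bool) → Set
  Convex I = ∀ a b e → Mem I a → Mem I e → a ≤P b → b ≤P e → Mem I b

  Interval : Carrier → Carrier → Carrier → Set
  Interval w z a = w ≤P a × a ≤P z

  -- [w,z] is a d_k-interval (k = r + 3)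
  DkInterval : ℕ → Carrier → Carrier → Set
  DkInterval r w z = Iso r (Interval w z) Whole

  IsDkIntervalSet : ℕ → (Carrier → Set) → Set
  IsDkIntervalSet r B =
    ∃[ w ] ∃[ z ] ((∀ a → B a ⇔ Interval w z a) × DkInterval r w z)

  DkMinusConvex : ℕ → (Carrier → Bool) → Set
  DkMinusConvex r I = Convex I × Iso r (Mem I) NotTop

  MaximalIn MinimalIn : (Carrier → Bool) → Carrier → Set
  MaximalIn I a = Mem I a × (∀ b → Mem I b → a ≤P b → b ≡ a)
  MinimalIn I a = Mem I a × (∀ b → Mem I b → b ≤P a → b ≡ a)

  record IsDComplete : Set where
    field
      D1 : ∀ r I → DkMinusConvex r I →
             ∃[ p ] ((∀ a → MaximalIn I a → a ⋖ p)
                    × IsDkIntervalSet r (λ a → Mem I a ⊎ a ≡ p))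
      D2 : ∀ r w z → DkInterval r w z → ∀ u → u ⋖ z → Interval w z u
      D3 : ∀ r I J → DkMinusConvex r I → DkMinusConvex r J →
             (∀ a → (Mem I a × ¬ MinimalIn I a) ⇔ (Mem J a × ¬ MinimalIn J a)) →
             ∀ a → Mem I a ⇔ Mem J a

  InTopTree : Carrier → Set
  InTopTree a = ∀ b → a ≤P b → ∀ u v → b ⋖ u → b ⋖ v → u ≡ v

  InNeck : Carrier → Set
  InNeck a = ∃[ r ] ∃[ w ] ∃[ z ] Σ (DkInterval r w z) λ φ →
               ∃[ i ] proj₁ (Iso.from φ (n i , _)) ≡ a

  Acyclic : Carrier → Set
  Acyclic a = InTopTree a × ¬ InNeck a

record CDPoset : Set₁ where
  field
    poset      : FPoset
    connected  : PosetNotions.Connected poset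
    dcomplete  : DComplete.IsDComplete poset
  open FPoset poset public

-- Ribbon Z^{(ℓ)}_S with ℓ = suc k; z_1,...,z_ℓ are
-- rib 0,...,rib k (0-based).  Edge i : Fin k joins rib (inject₁ i) and
-- rib (suc i) (paper index i+1), and S i = true means paper i+1 ∈ S,
-- i.e. z_{i+2} ⋖ z_{i+1} in paper numbering.

record Anchor (ℓ : ℕ) : Set₁ where
  field
    j          : Fin ℓ
    Q          : CDPoset
    q          : CDPoset.Carrier Q
    q-acyclic  : DComplete.Acyclic (CDPoset.poset Q) q

record Mobile : Set₁ where
  field
    k       : ℕ                     -- ℓ = suc k
    S       : Fin k → Bool
    nh      : ℕ                     -- total number of hanging posets
    attach  : Fin nh → Fin (suc k)  -- the ribbon element each hangs from
    D       : Fin nh → CDPoset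
    anchor  : Maybe (Anchor (suc k)) -- nothing = free-standing

module MobilePoset (M : Mobile) where
  open Mobile M

  AncC : Maybe (Anchor (suc k)) → Set
  AncC nothing  = ⊥
  AncC (just A) = CDPoset.Carrier (Anchor.Q A)

  AncG : (mA : Maybe (Anchor (suc k))) → AncC mA → AncC mA → Set
  AncG nothing  () _
  AncG (just A) a b = FPoset._≤P_ (CDPoset.poset (Anchor.Q A)) a b

  AncBase : (mA : Maybe (Anchor (suc k))) → Fin (suc k) → AncC mA → Set
  AncBase nothing  z ()
  AncBase (just A) z a = (z ≡ Anchor.j A) × (a ≡ Anchor.q A)

  data Elt : Set where
    rib  : Fin (suc k) → Elt
    hang : (h : Fin nh) → CDPoset.Carrier (D h) → Elt
    anc  : AncC anchor → Elt

  -- generating relations (x , y) meaning x ≤ y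
  data Gen : Elt → Elt → Set where
    gRibS  : ∀ i → T (S i)       → Gen (rib (fsuc i)) (rib (inject₁ i))
    gRibN  : ∀ i → T (not (S i)) → Gen (rib (inject₁ i)) (rib (fsuc i))
    gHang  : ∀ h a b → FPoset._≤P_ (CDPoset.poset (D h)) a b → Gen (hang h a) (hang h b)
    gTop   : ∀ h a → PosetNotions.Maximal (CDPoset.poset (D h)) a →
               Gen (hang h a) (rib (attach h))
    gAnc   : ∀ a b → AncG anchor a b → Gen (anc a) (anc b)
    gBase  : ∀ z a → AncBase anchor z a → Gen (rib z) (anc a)

  _≤M_ : Elt → Elt → Set
  _≤M_ = Star Gen

  _<M_ : Elt → Elt → Set
  a <M b = a ≤M b × a ≢ b

  _⋖M_ : Elt → Elt → Set
  a ⋖M b = a <M b × (∀ u → ¬ (a <M u × u <M b))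

  -- the ribbon cover relation attached to edge i, recorded as (lower , upper)
  ribPair : Fin k → Elt × Elt
  ribPair i = if S i then (rib (fsuc i) , rib (inject₁ i))
                     else (rib (inject₁ i) , rib (fsuc i))

  inFold : Maybe (Anchor (suc k)) → Fin k → Bool
  inFold nothing  i = S i
  inFold (just A) i =
    if S i then (toℕ i <ᵇ toℕ (Anchor.j A)) else not (toℕ i <ᵇ toℕ (Anchor.j A))

  FoldSet : Elt → Elt → Set
  FoldSet a b = ∃[ i ] (T (inFold anchor i) × ribPair i ≡ (a , b))

  _≤⊖_ : Elt → Elt → Set
  _≤⊖_ = Star (λ a b → (a ⋖M b) × ¬ FoldSet a b)

  SameComp : Elt → Elt → Set
  SameComp = EqClosure _≤⊖_

  -- edges of the component tree C(P_F): one per fold (x , y) ∈ F,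
  -- joining the components of x and y
  FoldEdge : Set
  FoldEdge = Σ (Fin k) (λ i → T (inFold anchor i))

  foldEnds : FoldEdge → Elt × Elt
  foldEnds (i , _) = ribPair i

-- A multigraph with vertex set V/~ (V with an equivalence-like relation ~),
-- edge set E and endpoint map ends is a path: it is isomorphic to the path
-- graph with vertices 0,...,m and edges {t, t+1}.

record IsPathGraph {V E : Set} (_~_ : V → V → Set) (ends : E → V × V) : Set where
  field
    m         : ℕ
    vtx       : Fin (suc m) → V
    vtx-inj   : ∀ a b → vtx a ~ vtx b → a ≡ b
    vtx-surj  : ∀ v → ∃[ a ] (v ~ vtx a)
    edge      : E ↔ Fin m
    edge-ends : ∀ e →
      ((proj₁ (ends e) ~ vtx (inject₁ (Inverse.to edge e)))
         × (proj₂ (ends e) ~ vtx (fsuc (Inverse.to edge e))))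
      ⊎ ((proj₁ (ends e) ~ vtx (fsuc (Inverse.to edge e)))
         × (proj₂ (ends e) ~ vtx (inject₁ (Inverse.to edge e))))

ComponentTreeIsPath : Mobile → Set
ComponentTreeIsPath M = IsPathGraph SameComp foldEnds
  where open MobilePoset M

-- Every element of a mobile lies in the component of P ⊖ F of a ribbon element:
-- a hanging poset is joined to the ribbon element it hangs from through covers
-- up to one of its maximal elements, and the anchored poset Q, being connected,
-- is joined to the anchor z_j through the cover z_j ⋖ q.  The folds are ribbon
-- covers and cut the ribbon z_1 … z_ℓ into blocks; the ribbon covers inside a
-- block are not folds, so each block is connected.  Conversely a cover of P that
-- is not a fold never changes the block of the ribbon position of an element,
-- since the generating relations move along the ribbon only through its edges.
-- So the components are the blocks, numbered left to right, and the fold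
-- between blocks t and t + 1 is the only edge of C(P_F) joining them.
module Submission where

open import Defs hiding (c; x; y; n)
open import Level using (0ℓ)
open import Data.Nat using (ℕ; zero; suc; _≤_; _<_; _⊓_; z≤n; s≤s)
import Data.Nat.Properties as ℕ
open import Data.Bool using (Bool; true; false; T; not; if_then_else_)
open import Data.Bool.Properties using (T-≡; T-not-≡; T-irrelevant)
open import Data.Empty using (⊥; ⊥-elim)
open import Data.Unit using (⊤; tt)
import Data.Fin as Fin
open import Data.Fin using (Fin; toℕ; fromℕ<; inject₁) renaming (zero to fzero; suc to fsuc)
open import Data.Fin.Induction using (po-noetherian; po-wellFounded; <-weakInduction)
open import Data.Fin.Properties
  using (any?; toℕ-injective; toℕ-fromℕ<; toℕ-inject₁; toℕ<n; toℕ≤pred[n])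
open import Data.Maybe using (Maybe; just; nothing)
open import Data.Product using (Σ; ∃-syntax; _×_; _,_; proj₁; proj₂)
open import Data.Product.Properties using (Σ-≡,≡→≡)
open import Data.Sum using (_⊎_; inj₁; inj₂)
open import Function using (flip; _∘_)
open import Function.Bundles using (Inverse; Equivalence; _↔_; mk↔ₛ′)
open import Induction.WellFounded using (WellFounded; Acc; acc; module Subrelation)
open import Relation.Binary
  using (Rel; IsEquivalence; IsPartialOrder; Decidable; DecidableEquality; tri<; tri≈; tri>)
import Relation.Binary.Construct.On as On
import Relation.Binary.PropositionalEquality as ≡
open import Relation.Binary.PropositionalEquality
  using (_≡_; _≢_; refl; sym; trans; cong; subst; subst₂; module ≡-Reasoning)
open import Relation.Binary.Construct.Closure.ReflexiveTransitive as Star using (Star; ε; _◅_; _◅◅_)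
import Relation.Binary.Construct.Closure.Equivalence as EqClosure
open import Relation.Nullary using (¬_; yes; no; contradiction)
open import Relation.Nullary.Decidable using (_×-dec_; ¬?; decidable-stable)
import Relation.Unary as U

module FinitePoset (P : FPoset) where
  open FPoset P
  open PosetNotions P
  open IsPartialOrder isPartialOrder using (antisym) renaming (refl to ≤P-refl; trans to ≤P-trans)
  open Inverse enum using () renaming (to to element; from to index; strictlyInverseˡ to element-index)

  _≟_ : DecidableEquality Carrier
  a ≟ b with ≤-dec a b | ≤-dec b a
  ... | yes a≤b | yes b≤a = yes (antisym a≤b b≤a)
  ... | no a≰b  | _       = no λ { refl → a≰b ≤P-refl }
  ... | _       | no b≰a  = no λ { refl → b≰a ≤P-refl }

  _<?_ : Decidable _<P_
  a <? b = ≤-dec a b ×-dec ¬? (a ≟ b)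

  private
    reindex : ∀ {a b} → a <P b → element (index a) <P element (index b)
    reindex {a} {b} = subst₂ _<P_ (sym (element-index a)) (sym (element-index b))

  <P-wellFounded : WellFounded _<P_
  <P-wellFounded = Subrelation.wellFounded reindex
    (On.wellFounded index (po-wellFounded (On.isPartialOrder element isPartialOrder)))

  <P-noetherian : WellFounded (flip _<P_)
  <P-noetherian = Subrelation.wellFounded reindex
    (On.wellFounded index (po-noetherian (On.isPartialOrder element isPartialOrder)))

  MaximalAbove : U.Pred Carrier 0ℓ → Carrier → Set
  MaximalAbove Q a = ∃[ m ] (a ≤P m × Q m × ∀ b → Q b → ¬ (m <P b))

  maximal-above : {Q : U.Pred Carrier 0ℓ} → U.Decidable Q → ∀ {a} → Q a → MaximalAbove Q a
  maximal-above {Q} Q? {a} = climb (<P-noetherian a)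
    where
    climb : ∀ {a} → Acc (flip _<P_) a → Q a → MaximalAbove Q a
    climb {a} (acc higher) Qa with any? (λ i → Q? (element i) ×-dec a <? element i)
    ... | yes (i , Qi , a<i) =
      let m , i≤m , Qm , m-max = climb (higher a<i) Qi in m , ≤P-trans (proj₁ a<i) i≤m , Qm , m-max
    ... | no none = a , ≤P-refl , Qa , λ b Qb a<b →
      none (index b , subst (λ e → Q e × a <P e) (sym (element-index b)) (Qb , a<b))

  exists-maximal-above : ∀ a → ∃[ m ] (a ≤P m × Maximal m)
  exists-maximal-above a with maximal-above {Q = λ _ → ⊤} (λ _ → yes tt) tt
  ... | m , a≤m , _ , m-max = m , a≤m , λ b m≤b →
    decidable-stable (b ≟ m) λ b≢m → m-max b tt (m≤b , λ { refl → b≢m refl })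

  ≤⇒cover-path : ∀ {a b} → a ≤P b → Star _⋖_ a b
  ≤⇒cover-path {a} {b} = descend (<P-wellFounded b)
    where
    descend : ∀ {b} → Acc _<P_ b → a ≤P b → Star _⋖_ a b
    descend {b} (acc lower) a≤b with a ≟ b
    ... | yes refl = ε
    ... | no a≢b with maximal-above (_<? b) (a≤b , a≢b)
    ...   | m , a≤m , m<b , m-max =
      descend (lower m<b) a≤m ◅◅ ((m<b , λ u (m<u , u<b) → m-max u u<b m<u) ◅ ε)

onℕ : ∀ {k} → (Fin k → Bool) → ℕ → Bool
onℕ {zero}  f _       = false
onℕ {suc k} f zero    = f fzero
onℕ {suc k} f (suc t) = onℕ (f ∘ fsuc) t

onℕ-toℕ : ∀ {k} (f : Fin k → Bool) i → onℕ f (toℕ i) ≡ f i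
onℕ-toℕ {suc k} f fzero    = refl
onℕ-toℕ {suc k} f (fsuc i) = onℕ-toℕ (f ∘ fsuc) i

-- Positions 0 … k on a path whose edge i joins positions i and i + 1; cutting
-- the edges with  cut i ≡ true  splits the path into blocks, and  block p  is
-- the number of cut edges left of position p, i.e. the index of its block.
module Blocks {k : ℕ} (cut : Fin k → Bool) where
  open ≡-Reasoning

  block : ℕ → ℕ
  block zero    = zero
  block (suc p) = if onℕ cut p then suc (block p) else block p

  block-cut : ∀ {p} → onℕ cut p ≡ true → block (suc p) ≡ suc (block p)
  block-cut c rewrite c = refl

  block-uncut : ∀ {p} → onℕ cut p ≡ false → block (suc p) ≡ block p
  block-uncut c rewrite c = refl

  block-flat⇒uncut : ∀ p → block (suc p) ≡ block p → onℕ cut p ≡ false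
  block-flat⇒uncut p flat with onℕ cut p
  ... | true  = contradiction flat ℕ.1+n≢n
  ... | false = refl

  block-≤-suc : ∀ p → block p ≤ block (suc p)
  block-≤-suc p with onℕ cut p
  ... | true  = ℕ.n≤1+n (block p)
  ... | false = ℕ.≤-refl

  block-suc-≤ : ∀ p → block (suc p) ≤ suc (block p)
  block-suc-≤ p with onℕ cut p
  ... | true  = ℕ.≤-refl
  ... | false = ℕ.n≤1+n (block p)

  block-mono : ∀ {p q} → p ≤ q → block p ≤ block q
  block-mono {q = zero}  z≤n = z≤n
  block-mono {q = suc q} p≤q with ℕ.m≤n⇒m<n∨m≡n p≤q
  ... | inj₁ (s≤s p≤q′) = ℕ.≤-trans (block-mono p≤q′) (block-≤-suc q)
  ... | inj₂ refl       = ℕ.≤-refl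

  block-surjective : ∀ {t} q → t ≤ block q → ∃[ p ] (p ≤ q × block p ≡ t)
  block-surjective zero    z≤n = zero , z≤n , refl
  block-surjective {t} (suc q) t≤b with t ℕ.≤? block q
  ... | yes t≤b′ = let p , p≤q , b≡t = block-surjective q t≤b′ in p , ℕ.m≤n⇒m≤1+n p≤q , b≡t
  ... | no  t≰b′ = suc q , ℕ.≤-refl , ℕ.≤-antisym (ℕ.≤-trans (block-suc-≤ q) (ℕ.≰⇒> t≰b′)) t≤b

  cut-at-block : ∀ {t} q → t < block q → ∃[ e ] (e < q × onℕ cut e ≡ true × block e ≡ t)
  cut-at-block {t} (suc q) t<b with onℕ cut q in c
  ... | false = let e , e<q , ce , be = cut-at-block q t<b in e , ℕ.m<n⇒m<1+n e<q , ce , be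
  ... | true with t ℕ.<? block q
  ...   | yes t<b′ = let e , e<q , ce , be = cut-at-block q t<b′ in e , ℕ.m<n⇒m<1+n e<q , ce , be
  ...   | no  t≮b′ = q , ℕ.≤-refl , c , ℕ.≤-antisym (ℕ.≮⇒≥ t≮b′) (ℕ.≤-pred t<b)

  block-cut-< : ∀ {e e′} → onℕ cut e ≡ true → e < e′ → block e < block e′
  block-cut-< c e<e′ = ℕ.≤-trans (ℕ.≤-reflexive (sym (block-cut c))) (block-mono e<e′)

  block-injective-on-cuts : ∀ {e e′} → onℕ cut e ≡ true → onℕ cut e′ ≡ true →
                            block e ≡ block e′ → e ≡ e′
  block-injective-on-cuts {e} {e′} c c′ b≡b′ with ℕ.<-cmp e e′
  ... | tri< e<e′ _ _ = contradiction b≡b′ (ℕ.<⇒≢ (block-cut-< c e<e′))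
  ... | tri≈ _ e≡e′ _ = e≡e′
  ... | tri> _ _ e>e′ = contradiction (sym b≡b′) (ℕ.<⇒≢ (block-cut-< c′ e>e′))

  cuts : ℕ
  cuts = block k

  blockIndex : Fin (suc k) → Fin (suc cuts)
  blockIndex z = fromℕ< (s≤s (block-mono (toℕ≤pred[n] z)))

  toℕ-blockIndex : ∀ z → toℕ (blockIndex z) ≡ block (toℕ z)
  toℕ-blockIndex z = toℕ-fromℕ< _

  blockIndex-≡⇒block-≡ : ∀ z z′ → blockIndex z ≡ blockIndex z′ → block (toℕ z) ≡ block (toℕ z′)
  blockIndex-≡⇒block-≡ z z′ eq = trans (sym (toℕ-blockIndex z)) (trans (cong toℕ eq) (toℕ-blockIndex z′))

  private
    representative : (t : Fin (suc cuts)) → ∃[ p ] (p ≤ k × block p ≡ toℕ t)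
    representative t = block-surjective k (toℕ≤pred[n] t)

  inBlock : Fin (suc cuts) → Fin (suc k)
  inBlock t = fromℕ< (s≤s (proj₁ (proj₂ (representative t))))

  blockIndex-inBlock : ∀ t → blockIndex (inBlock t) ≡ t
  blockIndex-inBlock t = toℕ-injective (begin
    toℕ (blockIndex (inBlock t))     ≡⟨ toℕ-blockIndex (inBlock t) ⟩
    block (toℕ (inBlock t))          ≡⟨ cong block (toℕ-fromℕ< (s≤s (proj₁ (proj₂ (representative t))))) ⟩
    block (proj₁ (representative t)) ≡⟨ proj₂ (proj₂ (representative t)) ⟩
    toℕ t                            ∎)

  blockIndex-uncut : ∀ {i} → cut i ≡ false → blockIndex (inject₁ i) ≡ blockIndex (fsuc i)
  blockIndex-uncut {i} c = toℕ-injective (begin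
    toℕ (blockIndex (inject₁ i))  ≡⟨ toℕ-blockIndex (inject₁ i) ⟩
    block (toℕ (inject₁ i))       ≡⟨ cong block (toℕ-inject₁ i) ⟩
    block (toℕ i)                 ≡⟨ block-uncut (trans (onℕ-toℕ cut i) c) ⟨
    block (suc (toℕ i))           ≡⟨ toℕ-blockIndex (fsuc i) ⟨
    toℕ (blockIndex (fsuc i))     ∎)

  module _ {ℓ} {R : Rel (Fin (suc k)) ℓ} (R-equiv : IsEquivalence R)
           (uncut-related : ∀ i → cut i ≡ false → R (inject₁ i) (fsuc i)) where
    open IsEquivalence R-equiv renaming (refl to R-refl; sym to R-sym; trans to R-trans)

    private
      BelowInBlock : Fin (suc k) → Set ℓ
      BelowInBlock z = ∀ z′ → toℕ z′ ≤ toℕ z → block (toℕ z′) ≡ block (toℕ z) → R z′ z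

      below-zero : BelowInBlock fzero
      below-zero fzero z≤n _ = R-refl

      below-suc : ∀ i → BelowInBlock (inject₁ i) → BelowInBlock (fsuc i)
      below-suc i ih z′ z′≤ b≡ with ℕ.m≤n⇒m<n∨m≡n z′≤
      ... | inj₂ z′≡ = reflexive (toℕ-injective z′≡)
      ... | inj₁ (s≤s z′≤i) = R-trans (ih z′ z′≤i′ b≡′) (uncut-related i uncut)
        where
        z′≤i′ : toℕ z′ ≤ toℕ (inject₁ i)
        z′≤i′ = subst (toℕ z′ ≤_) (sym (toℕ-inject₁ i)) z′≤i
        flat : block (suc (toℕ i)) ≡ block (toℕ i)
        flat = ℕ.≤-antisym (subst (_≤ block (toℕ i)) b≡ (block-mono z′≤i)) (block-≤-suc (toℕ i))
        uncut : cut i ≡ false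
        uncut = trans (sym (onℕ-toℕ cut i)) (block-flat⇒uncut (toℕ i) flat)
        b≡′ : block (toℕ z′) ≡ block (toℕ (inject₁ i))
        b≡′ = trans b≡ (trans flat (cong block (sym (toℕ-inject₁ i))))

      below : ∀ z → BelowInBlock z
      below = <-weakInduction BelowInBlock below-zero below-suc

    same-block⇒related : ∀ {z z′} → blockIndex z ≡ blockIndex z′ → R z z′
    same-block⇒related {z} {z′} eq with ℕ.≤-total (toℕ z) (toℕ z′)
    ... | inj₁ z≤z′ = below z′ z z≤z′ (blockIndex-≡⇒block-≡ z z′ eq)
    ... | inj₂ z′≤z = R-sym (below z z′ z′≤z (blockIndex-≡⇒block-≡ z′ z (sym eq)))

  Cut : Set
  Cut = Σ (Fin k) (T ∘ cut)

  private
    cut-onℕ : ∀ {i} → T (cut i) → onℕ cut (toℕ i) ≡ true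
    cut-onℕ {i} ci = trans (onℕ-toℕ cut i) (Equivalence.to T-≡ ci)

    cutAt : (t : Fin cuts) → ∃[ e ] (e < k × onℕ cut e ≡ true × block e ≡ toℕ t)
    cutAt t = cut-at-block k (toℕ<n t)

  cutIndex : Cut → Fin cuts
  cutIndex (i , ci) = fromℕ< (block-cut-< (cut-onℕ ci) (toℕ<n i))

  toℕ-cutIndex : ∀ c → toℕ (cutIndex c) ≡ block (toℕ (proj₁ c))
  toℕ-cutIndex (i , ci) = toℕ-fromℕ< (block-cut-< (cut-onℕ ci) (toℕ<n i))

  cutOfIndex : Fin cuts → Cut
  cutOfIndex t = let e , e<k , ce , _ = cutAt t in
    fromℕ< e<k , Equivalence.from T-≡ (begin
      cut (fromℕ< e<k)            ≡⟨ onℕ-toℕ cut (fromℕ< e<k) ⟨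
      onℕ cut (toℕ (fromℕ< e<k))  ≡⟨ cong (onℕ cut) (toℕ-fromℕ< e<k) ⟩
      onℕ cut e                   ≡⟨ ce ⟩
      true                        ∎)

  cut-index : Cut ↔ Fin cuts
  cut-index = mk↔ₛ′ cutIndex cutOfIndex index-cut cut-index-cut
    where
    index-cut : ∀ t → cutIndex (cutOfIndex t) ≡ t
    index-cut t = let e , e<k , _ , be = cutAt t in toℕ-injective (begin
      toℕ (cutIndex (cutOfIndex t)) ≡⟨ toℕ-cutIndex (cutOfIndex t) ⟩
      block (toℕ (fromℕ< e<k))      ≡⟨ cong block (toℕ-fromℕ< e<k) ⟩
      block e                       ≡⟨ be ⟩
      toℕ t                         ∎)
    cut-index-cut : ∀ c → cutOfIndex (cutIndex c) ≡ c
    cut-index-cut (i , ci) = let e , e<k , ce , be = cutAt (cutIndex (i , ci)) in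
      Σ-≡,≡→≡ (toℕ-injective (trans (toℕ-fromℕ< e<k)
                 (block-injective-on-cuts ce (cut-onℕ ci) (trans be (toℕ-cutIndex (i , ci)))))
              , T-irrelevant _ _)

  blockIndex-below-cut : ∀ c → blockIndex (inject₁ (proj₁ c)) ≡ inject₁ (cutIndex c)
  blockIndex-below-cut c@(i , _) = toℕ-injective (begin
    toℕ (blockIndex (inject₁ i))  ≡⟨ toℕ-blockIndex (inject₁ i) ⟩
    block (toℕ (inject₁ i))       ≡⟨ cong block (toℕ-inject₁ i) ⟩
    block (toℕ i)                 ≡⟨ toℕ-cutIndex c ⟨
    toℕ (cutIndex c)              ≡⟨ toℕ-inject₁ (cutIndex c) ⟨
    toℕ (inject₁ (cutIndex c))    ∎)

  blockIndex-above-cut : ∀ c → blockIndex (fsuc (proj₁ c)) ≡ fsuc (cutIndex c)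
  blockIndex-above-cut c@(i , ci) = toℕ-injective (begin
    toℕ (blockIndex (fsuc i))     ≡⟨ toℕ-blockIndex (fsuc i) ⟩
    block (suc (toℕ i))           ≡⟨ block-cut (cut-onℕ ci) ⟩
    suc (block (toℕ i))           ≡⟨ cong suc (toℕ-cutIndex c) ⟨
    suc (toℕ (cutIndex c))        ∎)

adjacent-beyond : ∀ {p r} → r ≢ p → r ≢ suc p → (p < r × suc p < r) ⊎ (r < p × r < suc p)
adjacent-beyond {p} {r} r≢p r≢1+p with ℕ.<-cmp r p
... | tri< r<p _ _ = inj₂ (r<p , ℕ.m<n⇒m<1+n r<p)
... | tri≈ _ r≡p _ = contradiction r≡p r≢p
... | tri> _ _ p<r = inj₁ (p<r , ℕ.≤∧≢⇒< p<r (r≢1+p ∘ sym))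

module MobileComponents (M : Mobile) where
  open Mobile M
  open MobilePoset M
  open Blocks (inFold anchor)
  module Hanging (h : Fin nh) = FPoset (CDPoset.poset (D h))

  -- The value for a free-standing mobile is junk: there are no anchor elements.
  anchorPosition : Maybe (Anchor (suc k)) → Fin (suc k)
  anchorPosition nothing  = fzero
  anchorPosition (just A) = Anchor.j A

  position : Elt → Fin (suc k)
  position (rib z)    = z
  position (hang h _) = attach h
  position (anc _)    = anchorPosition anchor

  base-position : ∀ {mA z a} → AncBase mA z a → z ≡ anchorPosition mA
  base-position {just A} (z≡j , _) = z≡j

  anc≰rib : ∀ {a z} → ¬ (anc a ≤M rib z)
  anc≰rib (gAnc _ _ _ ◅ w) = anc≰rib w

  anc≰hang : ∀ {a h b} → ¬ (anc a ≤M hang h b)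
  anc≰hang (gAnc _ _ _ ◅ w) = anc≰hang w

  rib≰hang : ∀ {z h b} → ¬ (rib z ≤M hang h b)
  rib≰hang (gRibS _ _ ◅ w)   = rib≰hang w
  rib≰hang (gRibN _ _ ◅ w)   = rib≰hang w
  rib≰hang (gBase _ _ _ ◅ w) = anc≰hang w

  data HangingLe (h : Fin nh) (a : Hanging.Carrier h) : (h′ : Fin nh) → Hanging.Carrier h′ → Set where
    same-hanging : ∀ {b} → Hanging._≤P_ h a b → HangingLe h a h b

  hang≤hang : ∀ {h a h′ b} → hang h a ≤M hang h′ b → HangingLe h a h′ b
  hang≤hang {h} ε = same-hanging (IsPartialOrder.refl (Hanging.isPartialOrder h))
  hang≤hang (gHang h _ _ a≤b ◅ w) with hang≤hang w
  ... | same-hanging b≤c = same-hanging (IsPartialOrder.trans (Hanging.isPartialOrder h) a≤b b≤c)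
  hang≤hang (gTop _ _ _ ◅ w) = ⊥-elim (rib≰hang w)

  hang≤rib⇒attach≤rib : ∀ {h a z} → hang h a ≤M rib z → rib (attach h) ≤M rib z
  hang≤rib⇒attach≤rib (gHang _ _ _ _ ◅ w) = hang≤rib⇒attach≤rib w
  hang≤rib⇒attach≤rib (gTop _ _ _ ◅ w)    = w

  rib≤anc⇒via-base : ∀ {z x} → rib z ≤M anc x →
                     ∃[ z′ ] ∃[ y ] (rib z ≤M rib z′ × AncBase anchor z′ y × anc y ≤M anc x)
  rib≤anc⇒via-base (g@(gRibS _ _) ◅ w) with rib≤anc⇒via-base w
  ... | z′ , y , w₁ , b , w₂ = z′ , y , g ◅ w₁ , b , w₂
  rib≤anc⇒via-base (g@(gRibN _ _) ◅ w) with rib≤anc⇒via-base w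
  ... | z′ , y , w₁ , b , w₂ = z′ , y , g ◅ w₁ , b , w₂
  rib≤anc⇒via-base (gBase z y b ◅ w) = z , y , ε , b , w

  rib≤rib⇒ascending : ∀ {a b} → rib a ≤M rib b →
                      ∀ i → toℕ a ≤ toℕ i → toℕ i < toℕ b → S i ≡ false
  rib≤rib⇒ascending ε i a≤i i<a = contradiction (ℕ.≤-<-trans a≤i i<a) (ℕ.<-irrefl refl)
  rib≤rib⇒ascending (gRibN e s ◅ w) i e≤i i<b
    with ℕ.m≤n⇒m<n∨m≡n (subst (_≤ toℕ i) (toℕ-inject₁ e) e≤i)
  ... | inj₁ e<i = rib≤rib⇒ascending w i e<i i<b
  ... | inj₂ e≡i = subst (λ j → S j ≡ false) (toℕ-injective e≡i) (Equivalence.to T-not-≡ s)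
  rib≤rib⇒ascending (gRibS e _ ◅ w) i e<i i<b =
    rib≤rib⇒ascending w i (subst (_≤ toℕ i) (sym (toℕ-inject₁ e)) (ℕ.<⇒≤ e<i)) i<b
  rib≤rib⇒ascending (gBase _ _ _ ◅ w) = ⊥-elim (anc≰rib w)

  rib≤rib⇒descending : ∀ {a b} → rib a ≤M rib b →
                       ∀ i → toℕ b ≤ toℕ i → toℕ i < toℕ a → S i ≡ true
  rib≤rib⇒descending ε i a≤i i<a = contradiction (ℕ.≤-<-trans a≤i i<a) (ℕ.<-irrefl refl)
  rib≤rib⇒descending (gRibS e s ◅ w) i b≤i i<e+1 with ℕ.m≤n⇒m<n∨m≡n (ℕ.≤-pred i<e+1)
  ... | inj₁ i<e = rib≤rib⇒descending w i b≤i (subst (toℕ i <_) (sym (toℕ-inject₁ e)) i<e)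
  ... | inj₂ i≡e = subst (λ j → S j ≡ true) (toℕ-injective (sym i≡e)) (Equivalence.to T-≡ s)
  rib≤rib⇒descending (gRibN e _ ◅ w) i b≤i i<e =
    rib≤rib⇒descending w i b≤i (ℕ.m<n⇒m<1+n (subst (toℕ i <_) (toℕ-inject₁ e) i<e))
  rib≤rib⇒descending (gBase _ _ _ ◅ w) = ⊥-elim (anc≰rib w)

  Beyond : Fin (suc k) → Fin (suc k) → Fin (suc k) → Set
  Beyond a b u = (toℕ a < toℕ u × toℕ b < toℕ u) ⊎ (toℕ u < toℕ a × toℕ u < toℕ b)

  -- An ascending and a descending walk would need the same edge next to u to point both ways.
  rib-no-detour : ∀ {a u b} → rib a ≤M rib u → rib u ≤M rib b → ¬ Beyond a b u
  rib-no-detour {u = fsuc e} a≤u u≤b (inj₁ (a<u , b<u)) = contradiction (trans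
    (sym (rib≤rib⇒ascending a≤u e (ℕ.≤-pred a<u) ℕ.≤-refl))
    (rib≤rib⇒descending u≤b e (ℕ.≤-pred b<u) ℕ.≤-refl)) λ ()
  rib-no-detour {a} {u} {b} a≤u u≤b (inj₂ (u<a , u<b)) = contradiction (trans
    (sym (rib≤rib⇒ascending u≤b e (ℕ.≤-reflexive (sym toℕ-e)) (subst (_< toℕ b) (sym toℕ-e) u<b)))
    (rib≤rib⇒descending a≤u e (ℕ.≤-reflexive (sym toℕ-e)) (subst (_< toℕ a) (sym toℕ-e) u<a))) λ ()
    where
    u<k = ℕ.<-≤-trans u<a (toℕ≤pred[n] a)
    e = fromℕ< u<k
    toℕ-e : toℕ e ≡ toℕ u
    toℕ-e = toℕ-fromℕ< u<k

  rib-antisym : ∀ {a b} → rib a ≤M rib b → rib b ≤M rib a → a ≡ b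
  rib-antisym {a} {b} a≤b b≤a with ℕ.<-cmp (toℕ a) (toℕ b)
  ... | tri< a<b _ _ = ⊥-elim (rib-no-detour a≤b b≤a (inj₁ (a<b , a<b)))
  ... | tri≈ _ a≡b _ = toℕ-injective a≡b
  ... | tri> _ _ b<a = ⊥-elim (rib-no-detour a≤b b≤a (inj₂ (b<a , b<a)))

  edge-beyond : ∀ i {u} → u ≢ inject₁ i → u ≢ fsuc i → Beyond (inject₁ i) (fsuc i) u
  edge-beyond i {u} u≢i u≢i+1 rewrite toℕ-inject₁ i =
    adjacent-beyond (λ eq → u≢i (toℕ-injective (trans eq (sym (toℕ-inject₁ i)))))
                    (λ eq → u≢i+1 (toℕ-injective eq))

  swap-Beyond : ∀ {a b u} → Beyond a b u → Beyond b a u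
  swap-Beyond (inj₁ (a<u , b<u)) = inj₁ (b<u , a<u)
  swap-Beyond (inj₂ (u<a , u<b)) = inj₂ (u<b , u<a)

  gen-ends-beyond : ∀ {a b u} → Gen (rib a) (rib b) → u ≢ a → u ≢ b → Beyond a b u
  gen-ends-beyond (gRibS i _) u≢i+1 u≢i = swap-Beyond (edge-beyond i u≢i u≢i+1)
  gen-ends-beyond (gRibN i _) u≢i u≢i+1 = edge-beyond i u≢i u≢i+1

  gen-ends-distinct : ∀ {a b} → Gen (rib a) (rib b) → a ≢ b
  gen-ends-distinct (gRibS i _) eq = ℕ.1+n≢n (trans (cong toℕ eq) (toℕ-inject₁ i))
  gen-ends-distinct (gRibN i _) eq = ℕ.1+n≢n (trans (cong toℕ (sym eq)) (toℕ-inject₁ i))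

  ribbon-cover : ∀ {a b} → Gen (rib a) (rib b) → rib a ⋖M rib b
  ribbon-cover {a} {b} g = (g ◅ ε , λ { refl → gen-ends-distinct g refl }) , no-between
    where
    no-between : ∀ u → ¬ (rib a <M u × u <M rib b)
    no-between (rib u) ((a≤u , a≢u) , (u≤b , u≢b)) =
      rib-no-detour a≤u u≤b (gen-ends-beyond g (a≢u ∘ cong rib ∘ sym) (u≢b ∘ cong rib))
    no-between (hang _ _) ((a≤u , _) , _) = rib≰hang a≤u
    no-between (anc _)    (_ , (u≤b , _)) = anc≰rib u≤b

  top-cover : ∀ h {m} → PosetNotions.Maximal (CDPoset.poset (D h)) m → hang h m ⋖M rib (attach h)
  top-cover h {m} m-max = (gTop h m m-max ◅ ε , λ ()) , no-between
    where
    no-between : ∀ u → ¬ (hang h m <M u × u <M rib (attach h))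
    no-between (hang _ x) ((m≤x , m≢x) , _) with hang≤hang m≤x
    ... | same-hanging m≤x′ = m≢x (cong (hang h) (sym (m-max x m≤x′)))
    no-between (rib z) ((m≤z , _) , (z≤t , z≢t)) =
      z≢t (cong rib (rib-antisym z≤t (hang≤rib⇒attach≤rib m≤z)))
    no-between (anc _) (_ , (u≤t , _)) = anc≰rib u≤t

  hang-cover : ∀ h {a b} → PosetNotions._⋖_ (CDPoset.poset (D h)) a b → hang h a ⋖M hang h b
  hang-cover h {a} {b} ((a≤b , a≢b) , no-between-D) =
    (gHang h a b a≤b ◅ ε , λ { refl → a≢b refl }) , no-between
    where
    no-between : ∀ u → ¬ (hang h a <M u × u <M hang h b)
    no-between (hang _ x) ((a≤x , a≢x) , (x≤b , x≢b)) with hang≤hang a≤x | hang≤hang x≤b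
    ... | same-hanging a≤x′ | same-hanging x≤b′ =
      no-between-D x ((a≤x′ , a≢x ∘ cong (hang h)) , (x≤b′ , x≢b ∘ cong (hang h)))
    no-between (rib _) (_ , (u≤b , _)) = rib≰hang u≤b
    no-between (anc _) (_ , (u≤b , _)) = anc≰hang u≤b

  -- Only the double negation: classifying the first step of a walk as a loop or
  -- not would need decidable equality of elements.
  cover⇒¬¬gen : ∀ {a b} → a ⋖M b → ¬ ¬ Gen a b
  cover⇒¬¬gen {a} {b} ((a≤b , a≢b) , no-between) ¬gen = walk refl a≤b
    where
    walk : ∀ {x} → x ≡ a → Star Gen x b → ⊥
    walk refl ε = a≢b refl
    walk refl (_◅_ {j = y} g y≤b) = y-not-new λ y≡a → walk y≡a y≤b
      where
      y≢b : y ≢ b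
      y≢b refl = ¬gen g
      y-not-new : ¬ (y ≢ a)
      y-not-new y≢a = no-between y ((g ◅ ε , y≢a ∘ sym) , (y≤b , y≢b))

  blockOf : Elt → Fin (suc cuts)
  blockOf = blockIndex ∘ position

  ribPair-descending : ∀ {i} → T (S i) → ribPair i ≡ (rib (fsuc i) , rib (inject₁ i))
  ribPair-descending {i} s with S i
  ... | true = refl

  ribPair-ascending : ∀ {i} → T (not (S i)) → ribPair i ≡ (rib (inject₁ i) , rib (fsuc i))
  ribPair-ascending {i} s with S i
  ... | false = refl

  gen-block : ∀ {a b} → Gen a b → ¬ FoldSet a b → blockOf a ≡ blockOf b
  gen-block (gRibS i s) unfolded with inFold anchor i in f
  ... | true  = ⊥-elim (unfolded (i , Equivalence.from T-≡ f , ribPair-descending s))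
  ... | false = sym (blockIndex-uncut f)
  gen-block (gRibN i s) unfolded with inFold anchor i in f
  ... | true  = ⊥-elim (unfolded (i , Equivalence.from T-≡ f , ribPair-ascending s))
  ... | false = blockIndex-uncut f
  gen-block (gHang _ _ _ _) _ = refl
  gen-block (gTop _ _ _)    _ = refl
  gen-block (gAnc _ _ _)    _ = refl
  gen-block (gBase _ _ b)   _ = cong blockIndex (base-position b)

  unfolded-cover-block : ∀ {a b} → a ⋖M b → ¬ FoldSet a b → blockOf a ≡ blockOf b
  unfolded-cover-block {a} {b} a⋖b unfolded =
    decidable-stable (blockOf a Fin.≟ blockOf b) λ a≢b →
      cover⇒¬¬gen a⋖b λ g → a≢b (gen-block g unfolded)

  ≤⊖⇒same-block : ∀ {a b} → a ≤⊖ b → blockOf a ≡ blockOf b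
  ≤⊖⇒same-block ε = refl
  ≤⊖⇒same-block ((a⋖b , unfolded) ◅ w) = trans (unfolded-cover-block a⋖b unfolded) (≤⊖⇒same-block w)

  SameComp⇒same-block : ∀ {a b} → SameComp a b → blockOf a ≡ blockOf b
  SameComp⇒same-block = EqClosure.gfold ≡.isEquivalence blockOf ≤⊖⇒same-block

  IsRib : Elt → Set
  IsRib (rib _) = ⊤
  IsRib _       = ⊥

  fold-ends-rib : ∀ {a b} → FoldSet a b → IsRib a × IsRib b
  fold-ends-rib (i , _ , refl) with S i
  ... | true  = tt , tt
  ... | false = tt , tt

  lowerEnd : Elt × Elt → ℕ
  lowerEnd (a , b) = toℕ (position a) ⊓ toℕ (position b)

  lowerEnd-ribPair : ∀ i → lowerEnd (ribPair i) ≡ toℕ i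
  lowerEnd-ribPair i with S i
  ... | true  rewrite toℕ-inject₁ i = ℕ.m≥n⇒m⊓n≡n (ℕ.n≤1+n (toℕ i))
  ... | false rewrite toℕ-inject₁ i = ℕ.m≤n⇒m⊓n≡m (ℕ.n≤1+n (toℕ i))

  ribPair-injective : ∀ {i i′} → ribPair i ≡ ribPair i′ → i ≡ i′
  ribPair-injective {i} {i′} eq =
    toℕ-injective (trans (sym (lowerEnd-ribPair i)) (trans (cong lowerEnd eq) (lowerEnd-ribPair i′)))

  unfolded-edge : ∀ {i} → inFold anchor i ≡ false → ¬ FoldSet (proj₁ (ribPair i)) (proj₂ (ribPair i))
  unfolded-edge {i} uf (i′ , fi′ , eq) = subst T uf (subst (T ∘ inFold anchor) (ribPair-injective eq) fi′)

  ribPair-cover : ∀ i → proj₁ (ribPair i) ⋖M proj₂ (ribPair i)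
  ribPair-cover i with S i in s
  ... | true  = ribbon-cover (gRibS i (Equivalence.from T-≡ s))
  ... | false = ribbon-cover (gRibN i (Equivalence.from T-not-≡ s))

  unfolded-cover : ∀ {a b} → a ⋖M b → ¬ FoldSet a b → SameComp a b
  unfolded-cover a⋖b unfolded = EqClosure.return ((a⋖b , unfolded) ◅ ε)

  uncut-edge-connected : ∀ i → inFold anchor i ≡ false → SameComp (rib (inject₁ i)) (rib (fsuc i))
  uncut-edge-connected i uf with S i | ribPair-cover i | unfolded-edge {i} uf
  ... | true  | cover | unfolded = EqClosure.symmetric _ (unfolded-cover cover unfolded)
  ... | false | cover | unfolded = unfolded-cover cover unfolded

  hang-connected : ∀ h a → SameComp (hang h a) (rib (attach h))
  hang-connected h a with FinitePoset.exists-maximal-above (CDPoset.poset (D h)) a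
  ... | m , a≤m , m-max = EqClosure.return
    (Star.gmap (hang h) (λ c → hang-cover h c , proj₁ ∘ fold-ends-rib)
               (FinitePoset.≤⇒cover-path (CDPoset.poset (D h)) a≤m)
     ◅◅ ((top-cover h m-max , proj₁ ∘ fold-ends-rib) ◅ ε))

  same-block⇒connected : ∀ {z z′} → blockIndex z ≡ blockIndex z′ → SameComp (rib z) (rib z′)
  same-block⇒connected =
    same-block⇒related (On.isEquivalence rib (EqClosure.isEquivalence _≤⊖_)) uncut-edge-connected

  connected-to-inBlock : ∀ {z t} → blockIndex z ≡ t → SameComp (rib z) (rib (inBlock t))
  connected-to-inBlock {t = t} eq = same-block⇒connected (trans eq (sym (blockIndex-inBlock t)))

  component-tree-is-path : (∀ x → SameComp (anc x) (rib (anchorPosition anchor))) → ComponentTreeIsPath M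
  component-tree-is-path anc-connected = record
    { m         = cuts
    ; vtx       = rib ∘ inBlock
    ; vtx-inj   = λ s t s~t → trans (sym (blockIndex-inBlock s))
                                (trans (SameComp⇒same-block s~t) (blockIndex-inBlock t))
    ; vtx-surj  = λ v → blockOf v , (connected-to-position v ◅◅ connected-to-inBlock refl)
    ; edge      = cut-index
    ; edge-ends = ends
    }
    where
    connected-to-position : ∀ v → SameComp v (rib (position v))
    connected-to-position (rib _)    = ε
    connected-to-position (hang h a) = hang-connected h a
    connected-to-position (anc x)    = anc-connected x

    lower-end : ∀ c → SameComp (rib (inject₁ (proj₁ c))) (rib (inBlock (inject₁ (cutIndex c))))
    lower-end c = connected-to-inBlock (blockIndex-below-cut c)

    upper-end : ∀ c → SameComp (rib (fsuc (proj₁ c))) (rib (inBlock (fsuc (cutIndex c))))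
    upper-end c = connected-to-inBlock (blockIndex-above-cut c)

    Joins : Elt × Elt → Fin cuts → Set
    Joins (a , b) t = (SameComp a (rib (inBlock (inject₁ t))) × SameComp b (rib (inBlock (fsuc t))))
                    ⊎ (SameComp a (rib (inBlock (fsuc t))) × SameComp b (rib (inBlock (inject₁ t))))

    ends : ∀ c → Joins (foldEnds c) (cutIndex c)
    ends c@(i , _) with S i
    ... | true  = inj₂ (upper-end c , lower-end c)
    ... | false = inj₁ (lower-end c , upper-end c)

-- Matching on the record makes  anchor ≡ just A  definitional, so that the
-- anchor relations of the mobile reduce to the order of Q.
anchor-connected : (M : Mobile) → let open MobilePoset M; open MobileComponents M in
                   ∀ x → SameComp (anc x) (rib (anchorPosition (Mobile.anchor M)))
anchor-connected record { anchor = nothing } ()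
anchor-connected M@record { anchor = just A } x =
  EqClosure.gmap anc lift (proj₂ (CDPoset.connected Q) x q)
  ◅◅ EqClosure.symmetric _ (unfolded-cover base-cover (proj₂ ∘ fold-ends-rib))
  where
  open Anchor A
  open MobilePoset M
  open MobileComponents M
  open FPoset (CDPoset.poset Q) using () renaming (_≤P_ to _≤Q_; isPartialOrder to Q-isPartialOrder)
  open PosetNotions (CDPoset.poset Q) using () renaming (_⋖_ to _⋖Q_)
  open IsPartialOrder Q-isPartialOrder using ()
    renaming (refl to ≤Q-refl; trans to ≤Q-trans; antisym to ≤Q-antisym)

  anc≤anc : ∀ {a b} → anc a ≤M anc b → a ≤Q b
  anc≤anc ε                  = ≤Q-refl
  anc≤anc (gAnc _ _ a≤b ◅ w) = ≤Q-trans a≤b (anc≤anc w)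

  anc-cover : ∀ {a b} → a ⋖Q b → anc a ⋖M anc b
  anc-cover {a} {b} ((a≤b , a≢b) , no-between-Q) =
    (gAnc a b a≤b ◅ ε , λ { refl → a≢b refl }) , no-between
    where
    no-between : ∀ u → ¬ (anc a <M u × u <M anc b)
    no-between (anc u) ((a≤u , a≢u) , (u≤b , u≢b)) =
      no-between-Q u ((anc≤anc a≤u , a≢u ∘ cong anc) , (anc≤anc u≤b , u≢b ∘ cong anc))
    no-between (rib _)    ((a≤u , _) , _) = anc≰rib a≤u
    no-between (hang _ _) ((a≤u , _) , _) = anc≰hang a≤u

  base-cover : rib j ⋖M anc q
  base-cover = (gBase j q (refl , refl) ◅ ε , λ ()) , no-between
    where
    no-between : ∀ u → ¬ (rib j <M u × u <M anc q)
    no-between (rib z) ((j≤z , j≢z) , (z≤q , _)) with rib≤anc⇒via-base z≤q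
    ... | _ , _ , z≤j , (refl , refl) , _ = j≢z (cong rib (rib-antisym j≤z z≤j))
    no-between (anc u) ((j≤u , _) , (u≤q , u≢q)) with rib≤anc⇒via-base j≤u
    ... | _ , _ , _ , (refl , refl) , q≤u = u≢q (cong anc (≤Q-antisym (anc≤anc u≤q) (anc≤anc q≤u)))
    no-between (hang _ _) ((j≤u , _) , _) = rib≰hang j≤u

  lift : ∀ {a b} → a ≤Q b → anc a ≤⊖ anc b
  lift a≤b = Star.gmap anc (λ c → anc-cover c , proj₁ ∘ fold-ends-rib)
                      (FinitePoset.≤⇒cover-path (CDPoset.poset Q) a≤b)

lemma4p7 : (M : Mobile) → ComponentTreeIsPath M
lemma4p7 M = MobileComponents.component-tree-is-path M (anchor-connected M)
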